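{- Let $G$ be a proper circular-arc graph with non-bipartite complement, and let $\prec$ be any arc ordering of the closed neighborhood hypergraph $\mathcal{N}[G]$. Then for every vertex $u\in V(G)$, writing $N[u]=[u^-,u^+]$ as an arc of $(V(G),\prec)$, both arcs $[u^-,u]$ and $[u,u^+]$ are cliques in $G$.
   Context: $N[v]$ is the closed neighborhood of $v$ and $\mathcal{N}[G]$ is the hypergraph on $V(G)$ with hyperedges $\{N[v]: v\in V(G)\}$. A PCA graph is one having a representation by arcs of a circle, adjacency meaning intersection, in which no arc is contained in another. An arc ordering of a hypergraph is a circular ordering of its vertex set in which every hyperedge is a set of circularly consecutive vertices (an arc); for an arc $A$ that is neither empty nor the whole vertex set, $A=[a^-,a^+]$ means $A$ consists of the vertices met going forward (along the successor relation) from $a^-$ to $a^+$. For $G$ as in the claim, no vertex is universal, so each $N[u]$ is a proper nonempty arc and $u^-,u^+$ are uniquely determined. -}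

module Defs where

open import Data.Nat using (ℕ; _+_; _∸_; _≤_; _<_; _≤ᵇ_)
open import Data.Bool using (Bool; if_then_else_)
open import Data.Fin using (Fin; toℕ)
open import Data.Product using (Σ; ∃; ∃-syntax; _×_; _,_)
open import Data.Sum using (_⊎_)
open import Data.Empty using (⊥)
open import Relation.Nullary using (¬_)
open import Relation.Binary.PropositionalEquality using (_≡_; _≢_)
open import Function.Definitions using (Injective)
open import Function.Bundles using (_⇔_)

record Graph (n : ℕ) : Set₁ where
  field
    Adj   : Fin n → Fin n → Set
    sym   : ∀ {u v} → Adj u v → Adj v u
    irrefl : ∀ {u} → ¬ Adj u u

open Graph public

ClosedNbhd : ∀ {n} → Graph n → Fin n → Fin n → Set
ClosedNbhd G v w = (w ≡ v) ⊎ Adj G v w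

IsClique : ∀ {n} → Graph n → (Fin n → Set) → Set
IsClique G S = ∀ x y → S x → S y → x ≢ y → Adj G x y

IsBipartite : ∀ {n} → Graph n → Set
IsBipartite {n} G = Σ (Fin n → Bool) λ c → (∀ (u v : Fin n) → Adj G u v → c u ≢ c v)

complement : ∀ {n} → Graph n → Graph n
complement G = record
  { Adj = λ u v → (u ≢ v) × ¬ Adj G u v
  ; sym = λ { (u≢v , ¬a) → (λ e → u≢v (symm e)) , (λ a → ¬a (Graph.sym G a)) }
  ; irrefl = λ { (u≢u , _) → u≢u reflP }
  }
  where
  open import Relation.Binary.PropositionalEquality using () renaming (sym to symm; refl to reflP)

fdist : ℕ → ℕ → ℕ → ℕ
fdist m a b = if a ≤ᵇ b then b ∸ a else (m + b) ∸ a

-- A circular ordering of Fin n: a bijective position map Fin n → Fin n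
-- (successor of x is the element at position pos x + 1 mod n).
record CircOrder (n : ℕ) : Set where
  field
    pos    : Fin n → Fin n
    pos-inj : Injective _≡_ _≡_ pos

open CircOrder public

-- x ∈ [a , b] w.r.t. circular order σ: x is met going forward from a
-- before (or at) reaching b.
InArc : ∀ {n} → CircOrder n → Fin n → Fin n → Fin n → Set
InArc {n} σ a b x =
  fdist n (toℕ (pos σ a)) (toℕ (pos σ x)) ≤ fdist n (toℕ (pos σ a)) (toℕ (pos σ b))

-- S (a set of vertices) is an arc of σ : empty, or of the form [a , b]
-- (the whole set is [a , pred a]).
IsArc : ∀ {n} → CircOrder n → (Fin n → Set) → Set
IsArc {n} σ S = (∀ x → ¬ S x) ⊎ (∃[ a ] ∃[ b ] (∀ x → S x ⇔ InArc σ a b x))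

IsArcOrderingN : ∀ {n} → Graph n → CircOrder n → Set
IsArcOrderingN G σ = ∀ v → IsArc σ (ClosedNbhd G v)

-- The circle is modelled by m points 0,…,m-1 in cyclic order; an arc is
-- a nonempty set of cyclically consecutive points, given by a start s and
-- a length ℓ with 1 ≤ ℓ ≤ m.

record CArc (m : ℕ) : Set where
  constructor carc
  field
    start : Fin m
    len   : ℕ
    len-pos : 1 ≤ len
    len-le  : len ≤ m

_∈A_ : ∀ {m} → Fin m → CArc m → Set
_∈A_ {m} p A = fdist m (toℕ (CArc.start A)) (toℕ p) < CArc.len A

_⊆A_ : ∀ {m} → CArc m → CArc m → Set
A ⊆A B = ∀ p → p ∈A A → p ∈A B

record PCAModel {n} (G : Graph n) : Set where
  field
    m      : ℕ
    arc    : Fin n → CArc m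
    adj⇔   : ∀ u v → u ≢ v → (Adj G u v ⇔ (∃[ p ] (p ∈A arc u × p ∈A arc v)))
    proper : ∀ u v → u ≢ v → ¬ (arc u ⊆A arc v)

IsPCA : ∀ {n} → Graph n → Set
IsPCA G = PCAModel G

{-# OPTIONS --safe #-}
module Submission where

-- Suppose x, y ∈ [u, u⁺] are non-adjacent,
-- x met before y.  Then y ≠ u, [u, y] ⊆ N[u], and N[y], an interval containing u and
-- y but not x, must contain [y, u].  Such a pair u ≠ y two-colours the complement:
-- colour v ∈ (u, y] by whether [u, v] ⊆ N[v], and v ∈ (y, u] by whether [y, v] ⊈ N[v].
-- If p, q are non-adjacent neighbours of a with q ∈ [a, p], then N[q] ⊇ [a, q] (it
-- contains a and q but misses p ∈ [q, a]) while N[p] ⊉ [a, p] (it misses q), so p and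
-- q get different colours; non-adjacent p ∈ (u, y] and q ∈ (y, u] get [u, p] ⊆ N[p]
-- and [y, q] ⊆ N[q] in the same way.  Reversing the circular order turns the claim
-- for [u, u⁺] into the one for [u⁻, u].

open import Defs
open import Data.Nat using (ℕ; _+_; _∸_; _≤_; _<_; _≤ᵇ_; _≤?_)
open import Data.Nat.Properties
  using (≤-refl; ≤-trans; <⇒≤; <⇒≱; ≰⇒>; ≤∧≢⇒<; <-asym; ≤-antisym; <-≤-trans;
         m≤m+n; +-monoʳ-≤; +-cancelˡ-≤; ∸-monoˡ-≤; m∸n+n≡m; +-monoˡ-≤; ≤ᵇ-reflects-≤)
open import Data.Fin using (Fin; toℕ; _≟_)
open import Data.Fin.Properties using (toℕ<n; toℕ-injective; all?)
open import Data.Bool using (Bool; true; false; not)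
open import Data.Bool.Properties using (not-injective)
open import Data.Product using (_×_; _,_; ∃₂; proj₁; proj₂)
open import Data.Sum using (_⊎_; inj₁; inj₂)
open import Data.Empty using (⊥-elim)
open import Function using (_∘_)
open import Function.Bundles using (_⇔_; Equivalence)
open import Relation.Nullary using (¬_; Dec; yes; no; does; contradiction; ¬?)
open import Relation.Nullary.Decidable using (_×-dec_; _⊎-dec_; _→-dec_; map′; dec-true; dec-false)
open import Relation.Nullary.Reflects using (ofʸ; ofⁿ)
open import Relation.Binary.PropositionalEquality using (_≡_; _≢_; refl; subst₂; ≢-sym)

open Equivalence using (to; from)

Btw : ℕ → ℕ → ℕ → Set
Btw i j k = (i ≤ j × i ≤ k × k ≤ j) ⊎ (j < i × (i ≤ k ⊎ k ≤ j))

btw? : ∀ i j k → Dec (Btw i j k)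
btw? i j k = (i ≤? j ×-dec i ≤? k ×-dec k ≤? j) ⊎-dec (1 + j ≤? i ×-dec (i ≤? k ⊎-dec k ≤? j))

btw-start : ∀ i j → Btw i j i
btw-start i j with i ≤? j
... | yes i≤j = inj₁ (i≤j , ≤-refl , i≤j)
... | no i≰j  = inj₂ (≰⇒> i≰j , inj₁ ≤-refl)

btw-end : ∀ i j → Btw i j j
btw-end i j with i ≤? j
... | yes i≤j = inj₁ (i≤j , i≤j , ≤-refl)
... | no i≰j  = inj₂ (≰⇒> i≰j , inj₂ ≤-refl)

btw-opposite : ∀ {i j k} → i ≢ j → ¬ Btw i j k → Btw j i k
btw-opposite {i} {j} {k} i≢j k∉ with i ≤? j | j ≤? k | k ≤? i
... | yes i≤j | yes j≤k | _        = inj₂ (≤∧≢⇒< i≤j i≢j , inj₁ j≤k)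
... | yes i≤j | no _    | yes k≤i  = inj₂ (≤∧≢⇒< i≤j i≢j , inj₂ k≤i)
... | yes i≤j | no j≰k  | no k≰i   = contradiction (inj₁ (i≤j , <⇒≤ (≰⇒> k≰i) , <⇒≤ (≰⇒> j≰k))) k∉
... | no i≰j  | _       | _        = inj₁ (<⇒≤ j<i , <⇒≤ (≰⇒> k≰j) , <⇒≤ (≰⇒> i≰k))
  where
  j<i = ≰⇒> i≰j
  k≰j : ¬ k ≤ j
  k≰j k≤j = k∉ (inj₂ (j<i , inj₂ k≤j))
  i≰k : ¬ i ≤ k
  i≰k i≤k = k∉ (inj₂ (j<i , inj₁ i≤k))

btw-suffix : ∀ {i j l k} → Btw i j l → Btw l j k → Btw i j k
btw-suffix (inj₁ (i≤j , i≤l , _))   (inj₁ (_ , l≤k , k≤j)) = inj₁ (i≤j , ≤-trans i≤l l≤k , k≤j)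
btw-suffix (inj₁ (_ , _ , l≤j))     (inj₂ (j<l , _))       = contradiction l≤j (<⇒≱ j<l)
btw-suffix (inj₂ (j<i , inj₁ i≤l))  (inj₁ (l≤j , _ , _))   = contradiction (≤-trans i≤l l≤j) (<⇒≱ j<i)
btw-suffix (inj₂ (j<i , inj₁ i≤l))  (inj₂ (_ , inj₁ l≤k))  = inj₂ (j<i , inj₁ (≤-trans i≤l l≤k))
btw-suffix (inj₂ (j<i , inj₁ _))    (inj₂ (_ , inj₂ k≤j))  = inj₂ (j<i , inj₂ k≤j)
btw-suffix (inj₂ (j<i , inj₂ _))    (inj₁ (_ , _ , k≤j))   = inj₂ (j<i , inj₂ k≤j)
btw-suffix (inj₂ (_ , inj₂ l≤j))    (inj₂ (j<l , _))       = contradiction l≤j (<⇒≱ j<l)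

btw-prefix : ∀ {i j l k} → Btw i j l → Btw i l k → Btw i j k
btw-prefix (inj₁ (i≤j , _ , l≤j))   (inj₁ (_ , i≤k , k≤l)) = inj₁ (i≤j , i≤k , ≤-trans k≤l l≤j)
btw-prefix (inj₁ (_ , i≤l , _))     (inj₂ (l<i , _))       = contradiction i≤l (<⇒≱ l<i)
btw-prefix (inj₂ (j<i , inj₁ _))    (inj₁ (_ , i≤k , _))   = inj₂ (j<i , inj₁ i≤k)
btw-prefix (inj₂ (_ , inj₁ i≤l))    (inj₂ (l<i , _))       = contradiction i≤l (<⇒≱ l<i)
btw-prefix (inj₂ (j<i , inj₂ l≤j))  (inj₁ (i≤l , _ , _))   = contradiction (≤-trans i≤l l≤j) (<⇒≱ j<i)
btw-prefix (inj₂ (j<i , inj₂ _))    (inj₂ (_ , inj₁ i≤k))  = inj₂ (j<i , inj₁ i≤k)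
btw-prefix (inj₂ (j<i , inj₂ l≤j))  (inj₂ (_ , inj₂ k≤l))  = inj₂ (j<i , inj₂ (≤-trans k≤l l≤j))

btw-widenˡ : ∀ {i j l k} → l ≢ i → Btw i j l → Btw j i k → Btw l i k
btw-widenˡ l≢i (inj₁ (_ , i≤l , l≤j)) (inj₁ (j≤i , _ , _)) =
  contradiction (≤-antisym (≤-trans l≤j j≤i) i≤l) l≢i
btw-widenˡ l≢i (inj₁ (_ , i≤l , l≤j)) (inj₂ (_ , inj₁ j≤k)) =
  inj₂ (≤∧≢⇒< i≤l (≢-sym l≢i) , inj₁ (≤-trans l≤j j≤k))
btw-widenˡ l≢i (inj₁ (_ , i≤l , _)) (inj₂ (_ , inj₂ k≤i)) = inj₂ (≤∧≢⇒< i≤l (≢-sym l≢i) , inj₂ k≤i)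
btw-widenˡ _ (inj₂ (j<i , _)) (inj₂ (i<j , _)) = contradiction i<j (<-asym j<i)
btw-widenˡ l≢i (inj₂ (_ , inj₁ i≤l)) (inj₁ (_ , _ , k≤i)) = inj₂ (≤∧≢⇒< i≤l (≢-sym l≢i) , inj₂ k≤i)
btw-widenˡ _ (inj₂ (j<i , inj₂ l≤j)) (inj₁ (_ , j≤k , k≤i)) =
  inj₁ (≤-trans l≤j (<⇒≤ j<i) , ≤-trans l≤j j≤k , k≤i)

btw-widenʳ : ∀ {i j l k} → l ≢ i → Btw j i l → Btw i j k → Btw i l k
btw-widenʳ l≢i (inj₁ (_ , j≤l , l≤i)) (inj₁ (i≤j , _ , _)) =
  contradiction (≤-antisym l≤i (≤-trans i≤j j≤l)) l≢i
btw-widenʳ _ (inj₂ (_ , inj₁ j≤l)) (inj₁ (i≤j , i≤k , k≤j)) =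
  inj₁ (≤-trans i≤j j≤l , i≤k , ≤-trans k≤j j≤l)
btw-widenʳ l≢i (inj₂ (_ , inj₂ l≤i)) (inj₁ (_ , i≤k , _)) = inj₂ (≤∧≢⇒< l≤i l≢i , inj₁ i≤k)
btw-widenʳ _ (inj₂ (i<j , _)) (inj₂ (j<i , _)) = contradiction i<j (<-asym j<i)
btw-widenʳ l≢i (inj₁ (_ , _ , l≤i)) (inj₂ (_ , inj₁ i≤k)) = inj₂ (≤∧≢⇒< l≤i l≢i , inj₁ i≤k)
btw-widenʳ l≢i (inj₁ (_ , j≤l , l≤i)) (inj₂ (_ , inj₂ k≤j)) =
  inj₂ (≤∧≢⇒< l≤i l≢i , inj₂ (≤-trans k≤j j≤l))

m∸o≤n∸o⇒m≤n : ∀ {m n o} → o ≤ m → o ≤ n → m ∸ o ≤ n ∸ o → m ≤ n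
m∸o≤n∸o⇒m≤n {o = o} o≤m o≤n h = subst₂ _≤_ (m∸n+n≡m o≤m) (m∸n+n≡m o≤n) (+-monoˡ-≤ o h)

fdist-≤⇒Btw : ∀ {m i j k} → i < m → j < m → fdist m i k ≤ fdist m i j → Btw i j k
fdist-≤⇒Btw {m} {i} {j} {k} i<m j<m h
  with i ≤ᵇ j | ≤ᵇ-reflects-≤ i j | i ≤ᵇ k | ≤ᵇ-reflects-≤ i k
... | true  | ofʸ i≤j | true  | ofʸ i≤k = inj₁ (i≤j , i≤k , m∸o≤n∸o⇒m≤n i≤k i≤j h)
... | true  | ofʸ i≤j | false | ofⁿ _   =
  contradiction (m∸o≤n∸o⇒m≤n i≤m+k i≤j h) (<⇒≱ (<-≤-trans j<m (m≤m+n m k)))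
  where i≤m+k = ≤-trans (<⇒≤ i<m) (m≤m+n m k)
... | false | ofⁿ i≰j | true  | ofʸ i≤k = inj₂ (≰⇒> i≰j , inj₁ i≤k)
... | false | ofⁿ i≰j | false | ofⁿ _   =
  inj₂ (≰⇒> i≰j , inj₂ (+-cancelˡ-≤ m k j (m∸o≤n∸o⇒m≤n (i≤m+ k) (i≤m+ j) h)))
  where i≤m+ = λ l → ≤-trans (<⇒≤ i<m) (m≤m+n m l)

Btw⇒fdist-≤ : ∀ {m i j k} → k < m → Btw i j k → fdist m i k ≤ fdist m i j
Btw⇒fdist-≤ {m} {i} {j} {k} k<m k∈
  with i ≤ᵇ j | ≤ᵇ-reflects-≤ i j | i ≤ᵇ k | ≤ᵇ-reflects-≤ i k | k∈
... | true  | ofʸ _   | true  | ofʸ _   | inj₁ (_ , _ , k≤j)  = ∸-monoˡ-≤ i k≤j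
... | true  | ofʸ i≤j | _     | _       | inj₂ (j<i , _)      = contradiction i≤j (<⇒≱ j<i)
... | true  | ofʸ _   | false | ofⁿ i≰k | inj₁ (_ , i≤k , _)  = contradiction i≤k i≰k
... | false | ofⁿ _   | true  | ofʸ _   | _                   = ∸-monoˡ-≤ i (≤-trans (<⇒≤ k<m) (m≤m+n m j))
... | false | ofⁿ i≰j | false | ofⁿ _   | inj₁ (i≤j , _ , _)  = contradiction i≤j i≰j
... | false | ofⁿ _   | false | ofⁿ i≰k | inj₂ (_ , inj₁ i≤k) = contradiction i≤k i≰k
... | false | ofⁿ _   | false | ofⁿ _   | inj₂ (_ , inj₂ k≤j) = ∸-monoˡ-≤ i (+-monoʳ-≤ m k≤j)

-- The axioms come in pairs dual under reading the circle backwards, so that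
-- `reverse` below is again an instance.
record CyclicIntervals (V : Set) : Set₁ where
  field
    _∈[_,_]    : V → V → V → Set
    _∈?[_,_]   : ∀ x a b → Dec (x ∈[ a , b ])
    start∈     : ∀ a b → a ∈[ a , b ]
    end∈       : ∀ a b → b ∈[ a , b ]
    ∈-opposite : ∀ {a b x} → a ≢ b → ¬ x ∈[ a , b ] → x ∈[ b , a ]
    suffix⊆    : ∀ {a b c x} → c ∈[ a , b ] → x ∈[ c , b ] → x ∈[ a , b ]
    prefix⊆    : ∀ {a b c x} → c ∈[ a , b ] → x ∈[ a , c ] → x ∈[ a , b ]
    widenˡ     : ∀ {a b c x} → c ≢ a → c ∈[ a , b ] → x ∈[ b , a ] → x ∈[ c , a ]
    widenʳ     : ∀ {a b c x} → c ≢ a → c ∈[ b , a ] → x ∈[ a , b ] → x ∈[ a , c ]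

  ∈-total : ∀ s p q → p ∈[ s , q ] ⊎ q ∈[ s , p ]
  ∈-total s p q with p ∈?[ s , q ] | q ∈?[ s , p ]
  ... | yes p∈ | _      = inj₁ p∈
  ... | no _   | yes q∈ = inj₂ q∈
  ... | no p∉  | no q∉  = contradiction (widenʳ p≢s (∈-opposite s≢q p∉) (end∈ s q)) q∉
    where
    p≢s : p ≢ s
    p≢s refl = p∉ (start∈ s q)
    s≢q : s ≢ q
    s≢q refl = q∉ (start∈ s p)

reverse : ∀ {V} → CyclicIntervals V → CyclicIntervals V
reverse C = record
  { _∈[_,_]    = λ x a b → x ∈[ b , a ]
  ; _∈?[_,_]   = λ x a b → x ∈?[ b , a ]
  ; start∈     = λ a b → end∈ b a
  ; end∈       = λ a b → start∈ b a
  ; ∈-opposite = ∈-opposite ∘ ≢-sym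
  ; suffix⊆    = prefix⊆
  ; prefix⊆    = suffix⊆
  ; widenˡ     = widenʳ
  ; widenʳ     = widenˡ
  }
  where open CyclicIntervals C

IsInterval : ∀ {V} → CyclicIntervals V → (V → Set) → Set
IsInterval C S = ∃₂ λ s t → ∀ x → S x ⇔ x ∈[ s , t ]
  where open CyclicIntervals C

reverse-IsInterval : ∀ {V} {C : CyclicIntervals V} {S : V → Set} →
                     IsInterval C S → IsInterval (reverse C) S
reverse-IsInterval (s , t , S⇔) = t , s , S⇔

arcIntervals : ∀ {n} → CircOrder n → CyclicIntervals (Fin n)
arcIntervals {n} σ = record
  { _∈[_,_]    = λ x a b → InArc σ a b x
  ; _∈?[_,_]   = λ x a b → map′ fromBtw toBtw (btw? _ _ _)
  ; start∈     = λ a b → fromBtw (btw-start _ _)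
  ; end∈       = λ a b → fromBtw (btw-end _ _)
  ; ∈-opposite = λ a≢b x∉ → fromBtw (btw-opposite (a≢b ∘ P-injective) (x∉ ∘ fromBtw))
  ; suffix⊆    = λ c∈ x∈ → fromBtw (btw-suffix (toBtw c∈) (toBtw x∈))
  ; prefix⊆    = λ c∈ x∈ → fromBtw (btw-prefix (toBtw c∈) (toBtw x∈))
  ; widenˡ     = λ c≢a c∈ x∈ → fromBtw (btw-widenˡ (c≢a ∘ P-injective) (toBtw c∈) (toBtw x∈))
  ; widenʳ     = λ c≢a c∈ x∈ → fromBtw (btw-widenʳ (c≢a ∘ P-injective) (toBtw c∈) (toBtw x∈))
  }
  where
  P : Fin n → ℕ
  P v = toℕ (pos σ v)

  P-injective : ∀ {x y} → P x ≡ P y → x ≡ y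
  P-injective = pos-inj σ ∘ toℕ-injective

  toBtw : ∀ {a b x} → InArc σ a b x → Btw (P a) (P b) (P x)
  toBtw = fdist-≤⇒Btw (toℕ<n _) (toℕ<n _)

  fromBtw : ∀ {a b x} → Btw (P a) (P b) (P x) → InArc σ a b x
  fromBtw = Btw⇒fdist-≤ (toℕ<n _)

does-distinct : ∀ {A B : Set} (A? : Dec A) (B? : Dec B) → A → ¬ B → does A? ≢ does B?
does-distinct A? B? a ¬b rewrite dec-true A? a | dec-false B? ¬b = λ ()

arc-ordering⇒IsInterval : ∀ {n} (G : Graph n) (σ : CircOrder n) → IsArcOrderingN G σ →
                          ∀ v → IsInterval (arcIntervals σ) (ClosedNbhd G v)
arc-ordering⇒IsInterval _ _ ao v with ao v
... | inj₁ empty         = contradiction (inj₁ refl) (empty v)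
... | inj₂ (s , t , N⇔)  = s , t , N⇔

module IntervalNeighbourhoods {n} (G : Graph n) (C : CyclicIntervals (Fin n))
                              (N-interval : ∀ v → IsInterval C (ClosedNbhd G v)) where
  open CyclicIntervals C

  N[_] : Fin n → Fin n → Set
  N[ v ] = ClosedNbhd G v

  [_,_]⊆N[_] : Fin n → Fin n → Fin n → Set
  [ a , b ]⊆N[ v ] = ∀ {x} → x ∈[ a , b ] → N[ v ] x

  N-sym : ∀ {u v} → N[ u ] v → N[ v ] u
  N-sym (inj₁ refl) = inj₁ refl
  N-sym (inj₂ uv)   = inj₂ (sym G uv)

  N⇒Adj : ∀ {u v} → N[ u ] v → v ≢ u → Adj G u v
  N⇒Adj (inj₁ v≡u) v≢u = contradiction v≡u v≢u
  N⇒Adj (inj₂ uv)  _   = uv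

  co-adjacent⇒∉N : ∀ {p q} → Adj (complement G) p q → ¬ N[ p ] q
  co-adjacent⇒∉N (p≢q , _)  (inj₁ refl) = p≢q refl
  co-adjacent⇒∉N (_ , ¬pq)  (inj₂ pq)   = ¬pq pq

  N? : ∀ v x → Dec (N[ v ] x)
  N? v x with N-interval v
  ... | s , t , N⇔ = map′ (from (N⇔ x)) (to (N⇔ x)) (x ∈?[ s , t ])

  Adj? : ∀ u v → Dec (Adj G u v)
  Adj? u v with N? u v
  ... | yes (inj₁ refl) = no (irrefl G)
  ... | yes (inj₂ uv)   = yes uv
  ... | no v∉           = no (v∉ ∘ inj₂)

  [_,_]⊆N[_]? : ∀ a b v → Dec ([ a , b ]⊆N[ v ])
  [ a , b ]⊆N[ v ]? = map′ (λ h {x} → h x) (λ h x → h) (all? λ x → x ∈?[ a , b ] →-dec N? v x)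

  ⊆N-between : ∀ {v p q} → N[ v ] p → N[ v ] q → [ p , q ]⊆N[ v ] ⊎ [ q , p ]⊆N[ v ]
  ⊆N-between {v} {p} {q} p∈ q∈ with N-interval v
  ... | s , t , N⇔ with ∈-total s p q
  ...   | inj₁ p∈sq = inj₁ λ x∈ → from (N⇔ _) (prefix⊆ (to (N⇔ q) q∈) (suffix⊆ p∈sq x∈))
  ...   | inj₂ q∈sp = inj₂ λ x∈ → from (N⇔ _) (prefix⊆ (to (N⇔ p) p∈) (suffix⊆ q∈sp x∈))

  ⊆N-avoiding : ∀ {v p q z} → N[ v ] p → N[ v ] q → z ∈[ p , q ] → ¬ N[ v ] z → [ q , p ]⊆N[ v ]
  ⊆N-avoiding p∈ q∈ z∈ z∉ with ⊆N-between p∈ q∈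
  ... | inj₁ pq⊆ = contradiction (pq⊆ z∈) z∉
  ... | inj₂ qp⊆ = qp⊆

  ⊆N-back-to : ∀ {a b p q} → p ≢ a → p ∈[ a , b ] → q ∈[ b , a ] → N[ p ] a →
               Adj (complement G) p q → [ a , p ]⊆N[ p ]
  ⊆N-back-to p≢a p∈ q∈ a∈ pq = ⊆N-avoiding (inj₁ refl) a∈ (widenˡ p≢a p∈ q∈) (co-adjacent⇒∉N pq)

  reaches-back : Fin n → Fin n → Bool
  reaches-back a v = does ([ a , v ]⊆N[ v ]?)

  reaches-back-differs-nearer : ∀ {a p q} → Adj G a q → Adj (complement G) q p → q ∈[ a , p ] →
                        reaches-back a q ≢ reaches-back a p
  reaches-back-differs-nearer {a} {p} {q} aq qp q∈ =
    does-distinct ([ a , q ]⊆N[ q ]?) ([ a , p ]⊆N[ p ]?)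
      (⊆N-back-to q≢a q∈ (start∈ p a) (N-sym (inj₂ aq)) qp)
      (λ ap⊆ → co-adjacent⇒∉N (sym (complement G) qp) (ap⊆ q∈))
    where
    q≢a : q ≢ a
    q≢a refl = irrefl G aq

  reaches-back-differs : ∀ {a p q} → Adj G a p → Adj G a q → Adj (complement G) p q →
                         reaches-back a p ≢ reaches-back a q
  reaches-back-differs {a} {p} {q} ap aq pq with ∈-total a p q
  ... | inj₁ p∈ = reaches-back-differs-nearer ap pq p∈
  ... | inj₂ q∈ = ≢-sym (reaches-back-differs-nearer aq (sym (complement G) pq) q∈)

  complement-bipartite : ∀ {u y} → u ≢ y → [ u , y ]⊆N[ u ] → [ y , u ]⊆N[ y ] →
                         IsBipartite (complement G)
  complement-bipartite {u} {y} u≢y uy⊆ yu⊆ = colour , proper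
    where
    Inner : Fin n → Set
    Inner v = v ≢ u × v ∈[ u , y ]

    inner? : ∀ v → Dec (Inner v)
    inner? v = ¬? (v ≟ u) ×-dec v ∈?[ u , y ]

    colour : Fin n → Bool
    colour v with inner? v
    ... | yes _ = reaches-back u v
    ... | no _  = not (reaches-back y v)

    outer : ∀ {v} → ¬ Inner v → v ≢ y × v ∈[ y , u ]
    outer {v} v∉ with v ≟ u
    ... | yes refl = u≢y , end∈ y u
    ... | no v≢u   = (λ { refl → v∉ (v≢u , end∈ u y) }) , ∈-opposite u≢y (λ v∈ → v∉ (v≢u , v∈))

    adj-u : ∀ {v} → Inner v → Adj G u v
    adj-u (v≢u , v∈) = N⇒Adj (uy⊆ v∈) v≢u

    adj-y : ∀ {v} → ¬ Inner v → Adj G y v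
    adj-y v∉ = N⇒Adj (yu⊆ (proj₂ (outer v∉))) (proj₁ (outer v∉))

    across : ∀ {p q} → Inner p → ¬ Inner q → Adj (complement G) p q →
             reaches-back u p ≢ not (reaches-back y q)
    across {p} {q} p-in@(p≢u , p∈) q∉ pq =
      does-distinct ([ u , p ]⊆N[ p ]?) (¬? [ y , q ]⊆N[ q ]?) up⊆ (λ ¬yq⊆ → ¬yq⊆ yq⊆)
      where
      up⊆ : [ u , p ]⊆N[ p ]
      up⊆ = ⊆N-back-to p≢u p∈ (proj₂ (outer q∉)) (N-sym (inj₂ (adj-u p-in))) pq
      yq⊆ : [ y , q ]⊆N[ q ]
      yq⊆ = ⊆N-back-to (proj₁ (outer q∉)) (proj₂ (outer q∉)) p∈ (N-sym (inj₂ (adj-y q∉)))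
                       (sym (complement G) pq)

    proper : ∀ p q → Adj (complement G) p q → colour p ≢ colour q
    proper p q pq with inner? p | inner? q
    ... | yes p-in | yes q-in = reaches-back-differs (adj-u p-in) (adj-u q-in) pq
    ... | no p∉    | no q∉    = reaches-back-differs (adj-y p∉) (adj-y q∉) pq ∘ not-injective
    ... | yes p-in | no q∉    = across p-in q∉ pq
    ... | no p∉    | yes q-in = ≢-sym (across q-in p∉ (sym (complement G) pq))

  suffix⊆N : ∀ {u a b} → (∀ x → N[ u ] x ⇔ x ∈[ a , b ]) → [ u , b ]⊆N[ u ]
  suffix⊆N {u} N⇔ x∈ = from (N⇔ _) (suffix⊆ (to (N⇔ u) (inj₁ refl)) x∈)

  no-co-edge-within : ¬ IsBipartite (complement G) → ∀ {u b x y} → [ u , b ]⊆N[ u ] →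
                      x ∈[ u , y ] → y ∈[ u , b ] → ¬ Adj (complement G) x y
  no-co-edge-within ¬bip {u} {y = y} ub⊆ x∈ y∈ xy with y ≟ u
  ... | yes refl = co-adjacent⇒∉N (sym (complement G) xy) (ub⊆ (prefix⊆ y∈ x∈))
  ... | no y≢u   = ¬bip (complement-bipartite (≢-sym y≢u) uy⊆ yu⊆)
    where
    uy⊆ : [ u , y ]⊆N[ u ]
    uy⊆ w∈ = ub⊆ (prefix⊆ y∈ w∈)
    yu⊆ : [ y , u ]⊆N[ y ]
    yu⊆ = ⊆N-avoiding (N-sym (ub⊆ y∈)) (inj₁ refl) x∈ (co-adjacent⇒∉N (sym (complement G) xy))

  suffix-clique : ¬ IsBipartite (complement G) → ∀ {u b} → [ u , b ]⊆N[ u ] →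
                  IsClique G (λ x → x ∈[ u , b ])
  suffix-clique ¬bip {u} ub⊆ x y x∈ y∈ x≢y with Adj? x y
  ... | yes xy = xy
  ... | no ¬xy with ∈-total u x y
  ...   | inj₁ x∈uy = ⊥-elim (no-co-edge-within ¬bip ub⊆ x∈uy y∈ (x≢y , ¬xy))
  ...   | inj₂ y∈ux = ⊥-elim (no-co-edge-within ¬bip ub⊆ y∈ux x∈ (≢-sym x≢y , ¬xy ∘ sym G))

lemma3p3 : ∀ {n : ℕ} (G : Graph n) → IsPCA G → ¬ IsBipartite (complement G)
    → (σ : CircOrder n) → IsArcOrderingN G σ
    → ∀ (u a b : Fin n) → (∀ x → ClosedNbhd G u x ⇔ InArc σ a b x)
    → IsClique G (InArc σ a u) × IsClique G (InArc σ u b)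
lemma3p3 G _ ¬bip σ ao u a b N⇔ = backward.suffix-clique ¬bip (backward.suffix⊆N N⇔)
                                 , forward.suffix-clique ¬bip (forward.suffix⊆N N⇔)
  where
  N-interval : ∀ v → IsInterval (arcIntervals σ) (ClosedNbhd G v)
  N-interval = arc-ordering⇒IsInterval G σ ao

  module forward  = IntervalNeighbourhoods G (arcIntervals σ) N-interval
  module backward = IntervalNeighbourhoods G (reverse (arcIntervals σ))
                      (λ v → reverse-IsInterval {C = arcIntervals σ} (N-interval v))
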